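{- Let $G$ be a finite graph and $t\ge 0$ an integer, and let $k$ be the largest clique cover width $CCW(H)$ over all $t$-shallow minors $H$ of $G$. Then $\hat\beta_t(G)\le k+1$.
   Context: All graphs are finite, simple and undirected. A $t$-shallow minor of $G$ is a graph $H$ obtained from $G$ by choosing pairwise disjoint vertex sets $V_1,\dots,V_m\subseteq V(G)$, each inducing a connected subgraph of radius at most $t$, contracting each $V_i$ to a single vertex $v_i$ and deleting all other vertices; $v_iv_j$ ($i\neq j$) is an edge of $H$ iff $G$ has an edge between $V_i$ and $V_j$. For a graph $H$, $\beta(H)$ is the minimum number of pairwise disjoint cliques partitioning $V(H)$; for $x\in V(H)$, $H_x$ is the subgraph induced by the closed neighborhood of $x$; $\tilde\beta(H)=\min_{x\in V(H)}\beta(H_x)$; and $\hat\beta_t(G)$ is the maximum of $\tilde\beta(H)$ over all $t$-shallow minors $H$ of $G$. A clique cover of $H$ is a partition $C$ of $V(H)$ into cliques; its clique cover graph is the graph obtained from $H$ by contracting each clique of $C$ into a single vertex. The clique cover width $CCW(H)$ is the minimum, over all clique covers $C$ of $H$, of the bandwidth of the clique cover graph of $C$. Equivalently, $CCW(H)$ is the minimum over ordered clique covers $(C_1,\dots,C_K)$ of $H$ of the maximum of $|j-i|$ over edges $ab$ of $H$ with $a\in C_i$, $b\in C_j$. -}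

module Defs where

open import Data.Nat using (ℕ; zero; suc; _≤_; _<_; ∣_-_∣)
open import Data.Fin using (Fin; toℕ)
open import Data.Bool using (Bool; true; false; T)
open import Data.Maybe using (Maybe; just)
open import Data.Product using (Σ; ∃; ∃-syntax; _×_; _,_)
open import Data.Sum using (_⊎_)
open import Relation.Nullary using (¬_)
open import Relation.Binary.PropositionalEquality using (_≡_; _≢_)
open import Function.Bundles using (_⇔_)

record Graph (n : ℕ) : Set where
  field
    adj   : Fin n → Fin n → Bool
    sym   : ∀ u v → adj u v ≡ adj v u
    irrefl : ∀ v → adj v v ≡ false

open Graph public

Edge : ∀ {n} → Graph n → Fin n → Fin n → Set
Edge G u v = T (adj G u v)

-- Reach G S t c v : there is a walk c = w₀ w₁ … w_ℓ = v in G with ℓ ≤ t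
-- whose vertices after the start all lie in S (the start c is required
-- to lie in S separately where used).
data Reach {n} (G : Graph n) (S : Fin n → Set) : ℕ → Fin n → Fin n → Set where
  here : ∀ {t c} → Reach G S t c c
  step : ∀ {t c u v} → Reach G S t c u → Edge G u v → S v → Reach G S (suc t) c v

-- H (on Fin m) is a t-shallow minor of G (on Fin n).
-- branch v = just i  means  v ∈ V_i  (so the V_i are pairwise disjoint);
-- each V_i has a center c_i ∈ V_i from which every vertex of V_i is at
-- distance ≤ t inside G[V_i] (i.e. G[V_i] is connected of radius ≤ t).
record ShallowMinor {n m} (t : ℕ) (G : Graph n) (H : Graph m) : Set where
  field
    branch    : Fin n → Maybe (Fin m)
    center    : Fin m → Fin n
    center-in : ∀ i → branch (center i) ≡ just i
    radius    : ∀ i v → branch v ≡ just i →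
                Reach G (λ u → branch u ≡ just i) t (center i) v
    edges     : ∀ i j → Edge H i j ⇔
                (i ≢ j × ∃[ u ] ∃[ v ] (branch u ≡ just i × branch v ≡ just j × Edge G u v))

-- CCW(H) ≤ k : there is an ordered clique cover (C_1,…,C_K) of H
-- (cover c : V(H) → Fin K, every class nonempty and a clique) such that
-- every edge ab of H with a ∈ C_i, b ∈ C_j has |j - i| ≤ k.
CCW≤ : ∀ {m} → Graph m → ℕ → Set
CCW≤ {m} H k =
  ∃[ K ] Σ (Fin m → Fin K) λ c → (
      (∀ (p : Fin K) → ∃[ a ] (c a ≡ p))
    × (∀ a b → c a ≡ c b → a ≢ b → Edge H a b)
    × (∀ a b → Edge H a b → ∣ toℕ {K} (c a) - toℕ (c b) ∣ ≤ k))

CCW≡ : ∀ {m} → Graph m → ℕ → Set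
CCW≡ H k = CCW≤ H k × (∀ k' → k' < k → ¬ CCW≤ H k')

N[_] : ∀ {m} {H : Graph m} → Fin m → Fin m → Set
N[_] {H = H} x y = y ≡ x ⊎ Edge H x y

-- β(H_x) ≤ b : the subgraph induced by N[x] can be partitioned into at
-- most b cliques (classes given by a colouring into Fin b; empty classes
-- are simply not counted).
βN≤ : ∀ {m} → (H : Graph m) → Fin m → ℕ → Set
βN≤ {m} H x b =
  Σ (Fin m → Fin b) λ c →
    ∀ y z → N[_] {H = H} x y → N[_] {H = H} x z → c y ≡ c z → y ≢ z → Edge H y z

β̃≤ : ∀ {m} → Graph m → ℕ → Set
β̃≤ {m} H b = ∃[ x ] βN≤ H x b

-- β̂_t(G) ≤ b : every (nonempty) t-shallow minor H has β̃(H) ≤ b.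
β̂≤ : ∀ {n} → ℕ → Graph n → ℕ → Set
β̂≤ t G b = ∀ m (H : Graph (suc m)) → ShallowMinor t G H → β̃≤ H b

MaxCCW : ∀ {n} → ℕ → Graph n → ℕ → Set
MaxCCW t G k =
    (∀ m (H : Graph m) → ShallowMinor t G H → CCW≤ H k)
  × (∃[ m ] Σ (Graph m) λ H → ShallowMinor t G H × CCW≡ H k)

-- Order the cliques of a witness for CCW(H) ≤ k as C₀, C₁, …, and pick x ∈ C₀. Every
-- neighbour of x lies in one of C₀, …, C_k, so these k + 1 cliques, restricted to N[x],
-- partition H_x into at most k + 1 cliques.
module Submission where

open import Defs
open import Data.Nat using (ℕ; suc; _≤_; s≤s; z≤n; ∣_-_∣)
open import Data.Nat.Properties using (m⊓n≤n; m≤n⇒m⊓n≡m)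
open import Data.Fin using (Fin; toℕ; fromℕ<) renaming (zero to fzero)
open import Data.Fin.Properties using (toℕ-fromℕ<; toℕ-injective)
open import Data.Product using (_,_)
open import Data.Sum using (inj₁; inj₂)
open import Relation.Binary.PropositionalEquality using (_≡_; _≢_; refl; trans; cong; subst)
  renaming (sym to ≡-sym)

clamp : ∀ {K} k → Fin K → Fin (suc k)
clamp k p = fromℕ< (s≤s (m⊓n≤n (toℕ p) k))

toℕ-clamp : ∀ {K} k (p : Fin K) → toℕ p ≤ k → toℕ (clamp k p) ≡ toℕ p
toℕ-clamp k p p≤k = trans (toℕ-fromℕ< (s≤s (m⊓n≤n (toℕ p) k))) (m≤n⇒m⊓n≡m p≤k)

clamp-injective : ∀ {K} k {p q : Fin K} → toℕ p ≤ k → toℕ q ≤ k →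
                  clamp k p ≡ clamp k q → p ≡ q
clamp-injective k {p} {q} p≤k q≤k eq = toℕ-injective
  (trans (≡-sym (toℕ-clamp k p p≤k)) (trans (cong toℕ eq) (toℕ-clamp k q q≤k)))

module _ {m K k} (H : Graph m) (c : Fin m → Fin (suc K))
         (cliques : ∀ a b → c a ≡ c b → a ≢ b → Edge H a b)
         (bandwidth : ∀ a b → Edge H a b → ∣ toℕ (c a) - toℕ (c b) ∣ ≤ k)
         {x : Fin m} (x∈C₀ : c x ≡ fzero) where

  N[x]-classes≤ : ∀ y → N[_] {H = H} x y → toℕ (c y) ≤ k
  N[x]-classes≤ y (inj₁ refl) rewrite x∈C₀ = z≤n
  N[x]-classes≤ y (inj₂ xy) =
    subst (λ p → ∣ toℕ p - toℕ (c y) ∣ ≤ k) x∈C₀ (bandwidth x y xy)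

  βN≤-first-class : βN≤ H x (suc k)
  βN≤-first-class = (λ y → clamp k (c y)) , partition
    where
    partition : ∀ y z → N[_] {H = H} x y → N[_] {H = H} x z →
                clamp k (c y) ≡ clamp k (c z) → y ≢ z → Edge H y z
    partition y z y∈N z∈N same = cliques y z
      (clamp-injective k (N[x]-classes≤ y y∈N) (N[x]-classes≤ z z∈N) same)

ccw≤⇒β̃≤ : ∀ {m} k (H : Graph (suc m)) → CCW≤ H k → β̃≤ H (suc k)
ccw≤⇒β̃≤ k H (0 , c , _) with c fzero
... | ()
ccw≤⇒β̃≤ k H (suc K , c , onto , cliques , bandwidth) with onto fzero
... | x , x∈C₀ = x , βN≤-first-class H c cliques bandwidth x∈C₀

theorem2 : ∀ (n : ℕ) (G : Graph n) (t k : ℕ) → MaxCCW t G k → β̂≤ t G (suc k)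
theorem2 n G t k (minors-CCW≤ , _) m H H≼G = ccw≤⇒β̃≤ k H (minors-CCW≤ (suc m) H H≼G)
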